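{- Let $f:\{0,1\}^n\to\{0,1\}$, $N=|f^{ -1}(1)|$, $a\in f^{ -1}(1)$, and $r\ge2\log N$. Then $f_{r,a}^{ -1}(1)\subseteq f^{ -1}(1)$, and the number of nontrivial coordinates of $f_{r,a}$ is at most $rN$.
   Context: $f_{r,a}(x)=f(x)$ if the Hamming distance $\Delta(x,a)\le r$, and $f_{r,a}(x)=0$ otherwise. For $g:\{0,1\}^n\to\{0,1\}$ with $g^{ -1}(1)\ne\emptyset$, a coordinate $i\in[n]$ is nontrivial for $g$ if $\Pr_{z\sim g^{ -1}(1)}[z_i=1]\notin\{0,1\}$, where $z$ is uniform over $g^{ -1}(1)$. Logarithms base 2. -}

module Defs where

open import Data.Nat using (ℕ; zero; suc; _≡ᵇ_; _≤ᵇ_)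
open import Data.Bool using (Bool; true; false; _∧_; not; _xor_)
open import Data.Fin using (Fin)
open import Data.List using (List; []; _∷_; length; filterᵇ; allFin; concatMap)
open import Data.Vec.Functional using () renaming (_∷_ to _∷ᶠ_)

-- Points of the Boolean cube {0,1}^n (true = 1)
Cube : ℕ → Set
Cube n = Fin n → Bool

allPoints : (n : ℕ) → List (Cube n)
allPoints zero = (λ ()) ∷ []
allPoints (suc n) = concatMap (λ v → (false ∷ᶠ v) ∷ (true ∷ᶠ v) ∷ []) (allPoints n)

count : {n : ℕ} → (Cube n → Bool) → ℕ
count {n} g = length (filterᵇ g (allPoints n))

hamming : {n : ℕ} → Cube n → Cube n → ℕ
hamming {n} x a = length (filterᵇ (λ i → x i xor a i) (allFin n))

restrict : {n : ℕ} → (Cube n → Bool) → ℕ → Cube n → Cube n → Bool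
restrict f r a x = f x ∧ (hamming x a ≤ᵇ r)

onesAt : {n : ℕ} → (Cube n → Bool) → Fin n → ℕ
onesAt g i = count (λ z → g z ∧ z i)

-- i is nontrivial for g: Pr_{z ~ g^{-1}(1)}[z_i = 1] = onesAt g i / count g ∉ {0,1},
-- i.e. onesAt g i ≠ 0 and onesAt g i ≠ count g  (g^{-1}(1) ≠ ∅ assumed by caller)
nontrivial : {n : ℕ} → (Cube n → Bool) → Fin n → Bool
nontrivial g i = not (onesAt g i ≡ᵇ 0) ∧ not (onesAt g i ≡ᵇ count g)

numNontrivial : {n : ℕ} → (Cube n → Bool) → ℕ
numNontrivial {n} g = length (filterᵇ (nontrivial g) (allFin n))

module Submission where

-- A coordinate on which every point of g⁻¹(1) agrees with a is trivial for g, so every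
-- nontrivial coordinate of g = f_{r,a} is one where some z ∈ g⁻¹(1) differs from a.
-- Each such z differs from a in at most Δ(z,a) ≤ r coordinates, and |g⁻¹(1)| ≤ N,
-- so a union bound gives at most rN nontrivial coordinates.

open import Defs
open import Data.Nat using (ℕ; _≤_; _*_; _^_; _+_; _≡ᵇ_; z≤n; s≤s)
open import Data.Nat.Properties
open import Data.Bool using (Bool; true; false; _∧_; _∨_; not; _xor_; T; T?)
open import Data.Bool.Properties using (T-∧; T-not-≡; ∧-conicalˡ)
open import Data.Bool.ListAction using (any)
open import Data.Product using (_×_; _,_; proj₁; proj₂)
open import Data.Fin using (Fin)
open import Data.Empty using (⊥-elim)
open import Data.List using (List; []; _∷_; length; filterᵇ; allFin)
open import Data.List.Properties using (filter-all; filter-none)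
open import Data.List.Relation.Unary.All as All using (All; []; _∷_)
open import Data.List.Relation.Unary.All.Properties using (all-filter; ¬Any⇒All¬)
open import Data.List.Relation.Unary.Any.Properties using (any⁺)
open import Data.List.Relation.Binary.Sublist.Propositional using (⊆-refl)
open import Data.List.Relation.Binary.Sublist.Propositional.Properties
  using (filter⁺; length-mono-≤)
open import Function using (_∘_; Equivalence)
open import Relation.Nullary using (¬_)
open import Relation.Binary.PropositionalEquality
  using (_≡_; _≢_; refl; sym; trans; cong; subst; module ≡-Reasoning)

open Equivalence using (to)

module _ {A : Set} where

  length-filterᵇ-mono : {p q : A → Bool} → (∀ {x} → T (p x) → T (q x)) →
    (xs : List A) → length (filterᵇ p xs) ≤ length (filterᵇ q xs)
  length-filterᵇ-mono {p} {q} p⇒q xs =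
    length-mono-≤ (filter⁺ (T? ∘ p) (T? ∘ q) (λ { refl → p⇒q }) (⊆-refl {x = xs}))

  length-filterᵇ-∨ : (p q : A → Bool) (xs : List A) →
    length (filterᵇ (λ x → p x ∨ q x) xs) ≤ length (filterᵇ p xs) + length (filterᵇ q xs)
  length-filterᵇ-∨ p q [] = z≤n
  length-filterᵇ-∨ p q (x ∷ xs) with p x | q x
  ... | true  | true  = s≤s (≤-trans (length-filterᵇ-∨ p q xs)
                                    (+-monoʳ-≤ (length (filterᵇ p xs)) (n≤1+n _)))
  ... | true  | false = s≤s (length-filterᵇ-∨ p q xs)
  ... | false | true  = ≤-trans (s≤s (length-filterᵇ-∨ p q xs))
                                (≤-reflexive (sym (+-suc (length (filterᵇ p xs)) _)))
  ... | false | false = length-filterᵇ-∨ p q xs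

  filterᵇ-∧ : (p q : A → Bool) (xs : List A) →
    filterᵇ (λ x → p x ∧ q x) xs ≡ filterᵇ q (filterᵇ p xs)
  filterᵇ-∧ p q [] = refl
  filterᵇ-∧ p q (x ∷ xs) with p x
  ... | false = filterᵇ-∧ p q xs
  ... | true with q x
  ...   | true  = cong (x ∷_) (filterᵇ-∧ p q xs)
  ...   | false = filterᵇ-∧ p q xs

  length-filterᵇ-any≤ : {B : Set} (P : B → A → Bool) (r : ℕ) (xs : List A)
    {zs : List B} → All (λ z → length (filterᵇ (P z) xs) ≤ r) zs →
    length (filterᵇ (λ x → any (λ z → P z x) zs) xs) ≤ r * length zs
  length-filterᵇ-any≤ P r xs [] = ≤-reflexive (begin
    length (filterᵇ (λ _ → false) xs) ≡⟨ cong length (filter-none (T? ∘ λ _ → false)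
                                                        (All.universal (λ _ ()) xs)) ⟩
    0                                 ≡⟨ sym (*-zeroʳ r) ⟩
    r * 0                             ∎)
    where open ≡-Reasoning
  length-filterᵇ-any≤ P r xs {z ∷ zs} (Pz≤r ∷ Pzs≤r) = begin
    length (filterᵇ (λ x → P z x ∨ any (λ z′ → P z′ x) zs) xs)
      ≤⟨ length-filterᵇ-∨ (P z) (λ x → any (λ z′ → P z′ x) zs) xs ⟩
    length (filterᵇ (P z) xs) + length (filterᵇ (λ x → any (λ z′ → P z′ x) zs) xs)
      ≤⟨ +-mono-≤ Pz≤r (length-filterᵇ-any≤ P r xs Pzs≤r) ⟩
    r + r * length zs
      ≡⟨ sym (*-suc r (length zs)) ⟩
    r * length (z ∷ zs) ∎
    where open ≤-Reasoning

¬T-xor⇒≡ : ∀ {x y} → ¬ T (x xor y) → x ≡ y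
¬T-xor⇒≡ {false} {false} _ = refl
¬T-xor⇒≡ {false} {true}  ¬t = ⊥-elim (¬t _)
¬T-xor⇒≡ {true}  {false} ¬t = ⊥-elim (¬t _)
¬T-xor⇒≡ {true}  {true}  _ = refl

T-not-≡ᵇ⇒≢ : ∀ {m n} → T (not (m ≡ᵇ n)) → m ≢ n
T-not-≡ᵇ⇒≢ {m} {n} t m≡n = subst T (to T-not-≡ t) (≡⇒≡ᵇ m n m≡n)

module _ {n : ℕ} (g : Cube n → Bool) (i : Fin n) where

  nontrivial⇒mixed : T (nontrivial g i) → onesAt g i ≢ 0 × onesAt g i ≢ count g
  nontrivial⇒mixed t with t₀ , t₁ ← to T-∧ t = T-not-≡ᵇ⇒≢ t₀ , T-not-≡ᵇ⇒≢ t₁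

  onesAt≡length-filterᵇ-support :
    onesAt g i ≡ length (filterᵇ (λ z → z i) (filterᵇ g (allPoints n)))
  onesAt≡length-filterᵇ-support = cong length (filterᵇ-∧ g (λ z → z i) (allPoints n))

  constant⇒¬nontrivial : (b : Bool) → All (λ z → z i ≡ b) (filterᵇ g (allPoints n)) →
    ¬ T (nontrivial g i)
  constant⇒¬nontrivial false zᵢ≡false nt = proj₁ (nontrivial⇒mixed nt)
    (trans onesAt≡length-filterᵇ-support
      (cong length (filter-none (T? ∘ λ z → z i) (All.map (λ e → subst T e) zᵢ≡false))))
  constant⇒¬nontrivial true zᵢ≡true nt = proj₂ (nontrivial⇒mixed nt)
    (trans onesAt≡length-filterᵇ-support
      (cong length (filter-all (T? ∘ λ z → z i)
                                (All.map (λ e → subst T (sym e) _) zᵢ≡true))))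

  nontrivial⇒differs : (a : Cube n) → T (nontrivial g i) →
    T (any (λ z → z i xor a i) (filterᵇ g (allPoints n)))
  nontrivial⇒differs a nt with any (λ z → z i xor a i) (filterᵇ g (allPoints n)) in noneDiffer
  ... | true  = _
  ... | false = constant⇒¬nontrivial (a i) agree nt
    where
    agree : All (λ z → z i ≡ a i) (filterᵇ g (allPoints n))
    agree = All.map ¬T-xor⇒≡
      (¬Any⇒All¬ _ (subst T noneDiffer ∘ any⁺ (λ z → z i xor a i)))

claim3p12 : (n : ℕ) (f : Cube n → Bool) (a : Cube n) (r : ℕ) →
    f a ≡ true →
    count f * count f ≤ 2 ^ r →
    ((x : Cube n) → restrict f r a x ≡ true → f x ≡ true)
    × numNontrivial (restrict f r a) ≤ r * count f
claim3p12 n f a r _ _ = (λ x → ∧-conicalˡ (f x) _) , bound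
  where
  g : Cube n → Bool
  g = restrict f r a

  S : List (Cube n)
  S = filterᵇ g (allPoints n)

  S-within-r : All (λ z → hamming z a ≤ r) S
  S-within-r = All.map (λ {z} t → ≤ᵇ⇒≤ (hamming z a) r (proj₂ (to T-∧ t)))
                    (all-filter (T? ∘ g) (allPoints n))

  open ≤-Reasoning
  bound : numNontrivial g ≤ r * count f
  bound = begin
    numNontrivial g
      ≤⟨ length-filterᵇ-mono (nontrivial⇒differs g _ a) (allFin n) ⟩
    length (filterᵇ (λ i → any (λ z → z i xor a i) S) (allFin n))
      ≤⟨ length-filterᵇ-any≤ (λ z i → z i xor a i) r (allFin n) S-within-r ⟩
    r * length S
      ≤⟨ *-monoʳ-≤ r (length-filterᵇ-mono (proj₁ ∘ to T-∧) (allPoints n)) ⟩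
    r * count f ∎
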